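{- Let $0<q<n$, $S\in\Sigma^n$ and $C\in\Sigma^q$, and suppose $C$ is a cover of $S$. Let $P=\{p_1<\dots<p_k\}$ be the set of starting positions of occurrences of $C$ in $S$ and $P'=\{p_i-1\mid i\in[k]\}$. Then $\gcd(\mathrm{Per}(C))$ divides $\gcd(P')$.
   Context: An integer $p$ with $1\le p\le |C|$ is a period of $C$ if $C[i]=C[i+p]$ for all $1\le i\le |C|-p$; $\mathrm{Per}(C)$ denotes the set of all periods of $C$. A string $C$ is a cover of $S$ if $|C|<|S|$ and every position $i$ of $S$ lies in an occurrence of $C$ in $S$, i.e. $C$ occurs in $S$ starting at some position in $\{\max(i-|C|+1,1),\dots,i\}$. Positions are 1-indexed. -}

module Defs where

open import Data.Nat using (ℕ; zero; suc; _+_; _∸_; _≤_; _<_)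
open import Data.Nat.Divisibility using (_∣_)
open import Data.Vec using (Vec; []; _∷_)
open import Data.Maybe using (Maybe; just; nothing)
open import Data.Product using (_×_; ∃; ∃-syntax)
open import Relation.Binary.PropositionalEquality using (_≡_)

-- 1-indexed character access: S ! i = just (S[i]) for 1 ≤ i ≤ |S|, nothing otherwise.
_!_ : ∀ {A : Set} {n : ℕ} → Vec A n → ℕ → Maybe A
[] ! _ = nothing
(x ∷ xs) ! zero = nothing
(x ∷ xs) ! suc zero = just x
(x ∷ xs) ! suc (suc i) = xs ! suc i

IsPeriod : ∀ {A : Set} {q : ℕ} → Vec A q → ℕ → Set
IsPeriod {q = q} C p = 1 ≤ p × p ≤ q × (∀ i → 1 ≤ i → i + p ≤ q → C ! i ≡ C ! (i + p))

OccursAt : ∀ {A : Set} {q n : ℕ} → Vec A q → Vec A n → ℕ → Set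
OccursAt {q = q} {n = n} C S p =
  1 ≤ p × p + q ∸ 1 ≤ n × (∀ j → 1 ≤ j → j ≤ q → S ! (p + j ∸ 1) ≡ C ! j)

IsCover : ∀ {A : Set} {q n : ℕ} → Vec A q → Vec A n → Set
IsCover {q = q} {n = n} C S =
  q < n × (∀ i → 1 ≤ i → i ≤ n → ∃[ p ] (OccursAt C S p × p ≤ i × i < p + q))

IsGCDOf : (ℕ → Set) → ℕ → Set
IsGCDOf X g = (∀ x → X x → g ∣ x) × (∀ d → (∀ x → X x → d ∣ x) → d ∣ g)

Per : ∀ {A : Set} {q : ℕ} → Vec A q → ℕ → Set
Per C p = IsPeriod C p

P′ : ∀ {A : Set} {q n : ℕ} → Vec A q → Vec A n → ℕ → Set
P′ C S x = ∃[ p ] (OccursAt C S p × x ≡ p ∸ 1)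

{-# OPTIONS --safe #-}
module Submission where

open import Defs
open import Data.Nat using (ℕ; zero; suc; s≤s; z≤n; _+_; _∸_; _≤_; _<_)
open import Data.Nat.Properties
  using (≤-trans; ≤-pred; <⇒≤; m≤m+n; m<m+n; m<n⇒0<n∸m; m≤n+o⇒m∸n≤o; m+[n∸m]≡n; +-assoc; +-comm)
open import Data.Nat.Divisibility using (_∣_; _∣0; ∣m∣n⇒∣m+n)
open import Data.Nat.Induction using (<-rec)
open import Data.Vec using (Vec)
open import Data.Product using (_×_; _,_; ∃₂)
open import Relation.Binary.PropositionalEquality using (_≡_; refl; sym; cong; subst; module ≡-Reasoning)

-- If C occurs at p > 1, position p - 1 is covered by an occurrence starting at
-- some p₀ with p - |C| ≤ p₀ < p, and the overlap of the two occurrences makes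
-- p - p₀ a period of C.  By induction every p - 1 is a sum of periods, so the
-- gcd of the periods divides every element of P′.

module _ {A : Set} {q n : ℕ} (C : Vec A q) (S : Vec A n) where

  occurrences-gap-isPeriod : ∀ {p d} → OccursAt C S p → OccursAt C S (p + d) →
                             1 ≤ d → d ≤ q → IsPeriod C d
  occurrences-gap-isPeriod {p} {d} (_ , _ , C≡S[p+]) (_ , _ , C≡S[p+d+]) 1≤d d≤q =
    1≤d , d≤q , λ i 1≤i i+d≤q → begin
      C ! i                    ≡⟨ sym (C≡S[p+d+] i 1≤i (≤-trans (m≤m+n i d) i+d≤q)) ⟩
      S ! (p + d + i ∸ 1)      ≡⟨ cong (λ k → S ! (k ∸ 1)) (shift i) ⟩
      S ! (p + (i + d) ∸ 1)    ≡⟨ C≡S[p+] (i + d) (≤-trans 1≤i (m≤m+n i d)) i+d≤q ⟩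
      C ! (i + d)              ∎
    where
    open ≡-Reasoning
    shift : ∀ i → p + d + i ≡ p + (i + d)
    shift i = begin
      p + d + i    ≡⟨ +-assoc p d i ⟩
      p + (d + i)  ≡⟨ cong (p +_) (+-comm d i) ⟩
      p + (i + d)  ∎

  cover⇒occurrence-one-period-earlier :
    IsCover C S → ∀ {i} → 1 ≤ i → OccursAt C S (suc i) →
    ∃₂ λ m d → OccursAt C S (suc m) × IsPeriod C d × i ≡ m + d
  cover⇒occurrence-one-period-earlier (_ , covered) {i} 1≤i occ@(_ , i+q≤n , _)
    with covered i 1≤i (≤-trans (m≤m+n i q) i+q≤n)
  ... | zero  , ((() , _) , _)
  ... | suc m , (occ₀ , m<i , i<1+m+q) =
    m , d , occ₀ , occurrences-gap-isPeriod occ₀ occ′ (m<n⇒0<n∸m m<i) d≤q , sym m+d≡i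
    where
    d : ℕ
    d = i ∸ m
    m+d≡i : m + d ≡ i
    m+d≡i = m+[n∸m]≡n (<⇒≤ m<i)
    occ′ : OccursAt C S (suc (m + d))
    occ′ = subst (λ k → OccursAt C S (suc k)) (sym m+d≡i) occ
    d≤q : d ≤ q
    d≤q = m≤n+o⇒m∸n≤o i m (≤-pred i<1+m+q)

  module _ (cover : IsCover C S) {g : ℕ} (g∣periods : ∀ d → Per C d → g ∣ d) where

    ∣occurrence-offset : ∀ i → OccursAt C S (suc i) → g ∣ i
    ∣occurrence-offset = <-rec (λ i → OccursAt C S (suc i) → g ∣ i) step
      where
      step : ∀ i → (∀ {j} → j < i → OccursAt C S (suc j) → g ∣ j) →
             OccursAt C S (suc i) → g ∣ i
      step zero    _  _   = g ∣0
      step (suc i) ih occ with cover⇒occurrence-one-period-earlier cover (s≤s z≤n) occ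
      ... | m , d , occ₀ , per@(1≤d , _) , 1+i≡m+d =
        subst (g ∣_) (sym 1+i≡m+d) (∣m∣n⇒∣m+n (ih m<1+i occ₀) (g∣periods d per))
        where
        m<1+i : m < suc i
        m<1+i = subst (m <_) (sym 1+i≡m+d) (m<m+n m 1≤d)

    ∣P′ : ∀ x → P′ C S x → g ∣ x
    ∣P′ x (suc i , occ , refl) = ∣occurrence-offset i occ
    ∣P′ x (zero  , (() , _) , _)

mainTheorem6 : {A : Set} (q n : ℕ) → 0 < q → q < n →
    (S : Vec A n) (C : Vec A q) → IsCover C S →
    (g g′ : ℕ) → IsGCDOf (Per C) g → IsGCDOf (P′ C S) g′ → g ∣ g′
mainTheorem6 q n _ _ S C cover g g′ (g∣periods , _) (_ , greatest′) =
  greatest′ g (∣P′ C S cover g∣periods)
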